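{- For every nonnegative integer $n$ and every complex number $x$, $${}_3F_2\left[\begin{matrix} 3x,\ 1-3x,\ -n\\ \tfrac12,\ -1-3n\end{matrix}\middle|\frac34\right]=3x\left[\begin{matrix} 1+x,\ 1-x\\ \frac23,\ \frac43\end{matrix}\right]_n+(1-3x)\left[\begin{matrix} \frac23+x,\ \frac43-x\\ \frac23,\ \frac43\end{matrix}\right]_n.$$
   Context: For a complex number $a$ and a nonnegative integer $m$, $(a)_m=a(a+1)\cdots(a+m-1)$ with $(a)_0=1$. The bracket notation means $\left[\begin{matrix} a_1,\dots,a_r\\ b_1,\dots,b_s\end{matrix}\right]_m=\frac{(a_1)_m\cdots(a_r)_m}{(b_1)_m\cdots(b_s)_m}$. For a nonnegative integer $n$, ${}_3F_2\left[\begin{matrix} a,\ b,\ -n\\ d,\ e\end{matrix}\middle|z\right]=\sum_{k=0}^{n}\frac{(a)_k(b)_k(-n)_k}{k!\,(d)_k(e)_k}z^k$. -}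

module Defs where

open import Level using (Level)
open import Data.Nat as ℕ using (ℕ; zero; suc)
open import Data.Integer as ℤ using (ℤ)
open import Data.Rational as ℚ using (ℚ; 0ℚ; 1ℚ)
open import Data.Rational.Properties as ℚP using (+-*-commutativeRing)
open import Relation.Nullary using (yes; no)
open import Algebra.Bundles using (CommutativeRing)
open import Algebra.Morphism.Structures using (module RingMorphisms)

private
  variable
    c ℓ : Level

ℚring : CommutativeRing _ _
ℚring = +-*-commutativeRing

IsQAlgebraMap : (R : CommutativeRing c ℓ) → (ℚ → CommutativeRing.Carrier R) → Set _
IsQAlgebraMap R φ =
  RingMorphisms.IsRingHomomorphism
    (CommutativeRing.rawRing ℚring) (CommutativeRing.rawRing R) φ

-- Total inverse on ℚ (0 ↦ 0); only ever applied to nonzero values below.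
invℚ : ℚ → ℚ
invℚ q with q ℚP.≟ 0ℚ
... | yes _ = 0ℚ
... | no q≢0 = ℚ.1/_ q {{ℚ.≢-nonZero q≢0}}

ℕ→ℚ : ℕ → ℚ
ℕ→ℚ n = ℤ.+ n ℚ./ 1

pochℚ : ℚ → ℕ → ℚ
pochℚ a zero = 1ℚ
pochℚ a (suc m) = pochℚ a m ℚ.* (a ℚ.+ ℕ→ℚ m)

powℚ : ℚ → ℕ → ℚ
powℚ q zero = 1ℚ
powℚ q (suc m) = powℚ q m ℚ.* q

factℚ : ℕ → ℚ
factℚ zero = 1ℚ
factℚ (suc m) = factℚ m ℚ.* ℕ→ℚ (suc m)

module _ (R : CommutativeRing c ℓ) where
  open CommutativeRing R

  poch : Carrier → ℕ → Carrier
  poch a zero = 1#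
  poch a (suc m) = poch a m * (a + fromℕ m)
    where
      fromℕ : ℕ → Carrier
      fromℕ zero = 0#
      fromℕ (suc k) = 1# + fromℕ k

  sumTo : (ℕ → Carrier) → ℕ → Carrier
  sumTo f zero = f 0
  sumTo f (suc n) = sumTo f n + f (suc n)

  module _ (φ : ℚ → Carrier) where
    -- 3F2[a, b, -n; d, e | z] with a, b ∈ R and d, e, z ∈ ℚ (image via φ):
    -- Σ_{k=0}^{n} (a)_k (b)_k (-n)_k z^k / (k! (d)_k (e)_k)
    F32 : Carrier → Carrier → ℕ → ℚ → ℚ → ℚ → Carrier
    F32 a b n d e z = sumTo term n
      where
        term : ℕ → Carrier
        term k = (poch a k * poch b k) *
          φ ((pochℚ (ℚ.- ℕ→ℚ n) k ℚ.* powℚ z k) ℚ.*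
             invℚ ((factℚ k ℚ.* pochℚ d k) ℚ.* pochℚ e k))

    -- [a1, a2; b1, b2]_m = (a1)_m (a2)_m / ((b1)_m (b2)_m), a's in R, b's in ℚ
    bracket : Carrier → Carrier → ℚ → ℚ → ℕ → Carrier
    bracket a1 a2 b1 b2 m =
      (poch a1 m * poch a2 m) * φ (invℚ (pochℚ b1 m ℚ.* pochℚ b2 m))

module Submission where

-- Zeilberger's method. As functions of n, both sides are annihilated by one second-order
-- operator p₂(n)E² + p₁(n)E + p₀(n), whose leading coefficient p₂(n) = (3n+2)(3n+4)(3n+5)(3n+7)
-- is a unit in every ℚ-algebra; so they agree once they agree at n = 0, 1, 2 (the recurrence
-- for the ₃F₂ is proved for n ≥ 1). For the right-hand side, a sum of two hypergeometric terms,
-- this is a polynomial identity. For the ₃F₂ it is creative telescoping: the operator maps the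
-- k-th summands to G(k+1) − G(k), where G is the summand times an explicit rational certificate,
-- and G vanishes just past the terminating range of summation.

open import Defs
open import Level using (Level)
open import Data.Nat as ℕ using (ℕ; zero; suc)
import Data.Nat.Properties as ℕP
import Data.Nat.Coprimality as Coprimality
open import Data.Integer as ℤ using ()
import Data.Integer.Properties as ℤP
open import Data.Rational as ℚ using (ℚ; ½; 1ℚ; 0ℚ; mkℚ)
import Data.Rational.Properties as ℚP
import Data.Rational.Unnormalised as ℚᵘ
import Data.Rational.Unnormalised.Properties as ℚᵘP
open import Data.Maybe using (Maybe; just; nothing)
open import Data.Product using (_,_; proj₁; _×_)
open import Data.Empty using (⊥-elim)
open import Relation.Nullary using (yes; no)
open import Relation.Binary.PropositionalEquality as P using (_≡_; _≢_)
open import Algebra.Bundles using (CommutativeRing)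
open import Algebra.Morphism.Structures using (module RingMorphisms)
open import Algebra.Morphism.Construct.Identity using (isRingHomomorphism)
import Algebra.Solver.Ring.AlmostCommutativeRing as ACR

ℕ→ℚ≡mkℚ : ∀ m → ℕ→ℚ m ≡ mkℚ (ℤ.+ m) 0 (Coprimality.sym (Coprimality.1-coprimeTo m))
ℕ→ℚ≡mkℚ m = ℚP.normalize-coprime _

ℕ→ℚ-suc : ∀ m → ℕ→ℚ (suc m) ≡ 1ℚ ℚ.+ ℕ→ℚ m
ℕ→ℚ-suc m = ℚP.toℚᵘ-injective (begin
  ℚ.toℚᵘ (ℕ→ℚ (suc m))            ≈⟨ ℚᵘP.≃-reflexive (P.cong ℚ.toℚᵘ (ℕ→ℚ≡mkℚ (suc m))) ⟩
  ℚᵘ.mkℚᵘ (ℤ.+ suc m) 0           ≈⟨ ℚᵘ.*≡* (P.trans (ℤP.*-identityʳ _) (P.sym (P.trans (ℤP.*-identityʳ _) (P.cong (ℤ._+_ (ℤ.+ 1)) (ℤP.*-identityʳ (ℤ.+ m)))))) ⟩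
  ℚᵘ.mkℚᵘ (ℤ.+ 1) 0 ℚᵘ.+ ℚᵘ.mkℚᵘ (ℤ.+ m) 0 ≈⟨ ℚᵘP.≃-reflexive (P.cong (λ q → ℚ.toℚᵘ 1ℚ ℚᵘ.+ ℚ.toℚᵘ q) (P.sym (ℕ→ℚ≡mkℚ m))) ⟩
  ℚ.toℚᵘ 1ℚ ℚᵘ.+ ℚ.toℚᵘ (ℕ→ℚ m)   ≈⟨ ℚᵘP.≃-sym (ℚP.toℚᵘ-homo-+ 1ℚ (ℕ→ℚ m)) ⟩
  ℚ.toℚᵘ (1ℚ ℚ.+ ℕ→ℚ m)           ∎)
  where open import Relation.Binary.Reasoning.Setoid ℚᵘP.≃-setoid

ℕ→ℚ-injective : ∀ {a b} → ℕ→ℚ a ≡ ℕ→ℚ b → a ≡ b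
ℕ→ℚ-injective {a} {b} eq =
  ℤP.+-injective (P.cong ℚ.numerator (P.trans (P.sym (ℕ→ℚ≡mkℚ a)) (P.trans eq (ℕ→ℚ≡mkℚ b))))

ℕ→ℚ-≢0 : ∀ {m} → m ≢ 0 → ℕ→ℚ m ≢ 0ℚ
ℕ→ℚ-≢0 m≢0 eq = m≢0 (ℕ→ℚ-injective eq)

module QAlgebra {c ℓ : Level} (R : CommutativeRing c ℓ) (φ : ℚ → CommutativeRing.Carrier R)
                (hom : IsQAlgebraMap R φ) where
  open CommutativeRing R public
  open RingMorphisms.IsRingHomomorphism hom public
    using () renaming (+-homo to φ-+; *-homo to φ-*; -‿homo to φ-neg; 0#-homo to φ-0; 1#-homo to φ-1)
  open import Relation.Binary.Reasoning.Setoid setoid public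
  open import Algebra.Definitions _≈_ using (LeftInvertible)

  φ-cong : ∀ {p q} → p ≡ q → φ p ≈ φ q
  φ-cong e = reflexive (P.cong φ e)

  -- The solver compares normal forms up to definitional equality, so the
  -- coefficients 0 and 1 must be interpreted as 0# and 1# on the nose.
  ψ : ℚ → Carrier
  ψ q with q ℚP.≟ 1ℚ
  ... | yes _ = 1#
  ... | no _ with q ℚP.≟ 0ℚ
  ...   | yes _ = 0#
  ...   | no _ = φ q

  ψ≈φ : ∀ q → ψ q ≈ φ q
  ψ≈φ q with q ℚP.≟ 1ℚ
  ... | yes q≡1 = sym (trans (φ-cong q≡1) φ-1)
  ... | no _ with q ℚP.≟ 0ℚ
  ...   | yes q≡0 = sym (trans (φ-cong q≡0) φ-0)
  ...   | no _ = refl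

  ψ-morphism : ACR._-Raw-AlmostCommutative⟶_ (CommutativeRing.rawRing ℚring) (ACR.fromCommutativeRing R)
  ψ-morphism = record
    { ⟦_⟧ = ψ
    ; +-homo = λ p q → trans (ψ≈φ _) (trans (φ-+ p q) (sym (+-cong (ψ≈φ p) (ψ≈φ q))))
    ; *-homo = λ p q → trans (ψ≈φ _) (trans (φ-* p q) (sym (*-cong (ψ≈φ p) (ψ≈φ q))))
    ; -‿homo = λ p → trans (ψ≈φ _) (trans (φ-neg p) (sym (-‿cong (ψ≈φ p))))
    ; 0-homo = trans (ψ≈φ _) φ-0
    ; 1-homo = trans (ψ≈φ _) φ-1
    }

  ψ-≟ : ∀ p q → Maybe (ψ p ≈ ψ q)
  ψ-≟ p q with p ℚP.≟ q
  ... | yes p≡q = just (reflexive (P.cong ψ p≡q))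
  ... | no _ = nothing

  open import Algebra.Solver.Ring (CommutativeRing.rawRing ℚring) (ACR.fromCommutativeRing R) ψ-morphism ψ-≟ public

  κ : ∀ {m} → ℕ → Polynomial m
  κ k = con (ℕ→ℚ k)

  ι : ℕ → Carrier
  ι m = φ (ℕ→ℚ m)

  ι-suc : ∀ m → ι (suc m) ≈ 1# + ι m
  ι-suc m = trans (φ-cong (ℕ→ℚ-suc m)) (trans (φ-+ 1ℚ (ℕ→ℚ m)) (+-congʳ φ-1))

  ι-+ : ∀ a b → ι (a ℕ.+ b) ≈ ι a + ι b
  ι-+ zero b = sym (trans (+-congʳ φ-0) (+-identityˡ _))
  ι-+ (suc a) b = begin
    ι (suc (a ℕ.+ b))  ≈⟨ ι-suc (a ℕ.+ b) ⟩
    1# + ι (a ℕ.+ b)   ≈⟨ +-congˡ (ι-+ a b) ⟩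
    1# + (ι a + ι b)   ≈⟨ sym (+-assoc _ _ _) ⟩
    (1# + ι a) + ι b   ≈⟨ +-congʳ (sym (ι-suc a)) ⟩
    ι (suc a) + ι b    ∎

  ι-* : ∀ a b → ι (a ℕ.* b) ≈ ι a * ι b
  ι-* zero b = trans φ-0 (sym (trans (*-congʳ φ-0) (zeroˡ _)))
  ι-* (suc a) b = begin
    ι (b ℕ.+ a ℕ.* b)  ≈⟨ ι-+ b _ ⟩
    ι b + ι (a ℕ.* b)  ≈⟨ +-congˡ (ι-* a b) ⟩
    ι b + ι a * ι b    ≈⟨ solve 2 (λ A B → B :+ A :* B := (κ 1 :+ A) :* B) refl (ι a) (ι b) ⟩
    (1# + ι a) * ι b   ≈⟨ *-congʳ (sym (ι-suc a)) ⟩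
    ι (suc a) * ι b    ∎

  ι-∸ : ∀ a b → b ℕ.≤ a → ι (a ℕ.∸ b) ≈ ι a - ι b
  ι-∸ a b b≤a = begin
    ι (a ℕ.∸ b)                ≈⟨ solve 2 (λ D B → D := (B :+ D) :- B) refl (ι (a ℕ.∸ b)) (ι b) ⟩
    (ι b + ι (a ℕ.∸ b)) - ι b  ≈⟨ +-congʳ (sym (ι-+ b (a ℕ.∸ b))) ⟩
    ι (b ℕ.+ (a ℕ.∸ b)) - ι b  ≈⟨ +-congʳ (φ-cong (P.cong ℕ→ℚ (ℕP.m+[n∸m]≡n b≤a))) ⟩
    ι a - ι b                  ∎

  nat : ℕ → Carrier
  nat zero = 0#
  nat (suc k) = 1# + nat k

  ι≈nat : ∀ k → ι k ≈ nat k
  ι≈nat zero = φ-0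
  ι≈nat (suc k) = trans (ι-suc k) (+-congˡ (ι≈nat k))

  -- The offset k inside poch is a function local to Defs that is never named here;
  -- the shift identity lets us relate it to nat without mentioning it.
  poch-shift : ∀ a m → poch R a (suc m) ≈ a * poch R (1# + a) m
  poch-shift a zero = solve 1 (λ A → κ 1 :* (A :+ κ 0) := A :* κ 1) refl a
  poch-shift a (suc m) = trans (*-congʳ (poch-shift a m))
    (solve 3 (λ A P K → (A :* P) :* (A :+ (κ 1 :+ K)) := A :* (P :* ((κ 1 :+ A) :+ K))) refl a (poch R (1# + a) m) _)

  poch-suc : ∀ a m → poch R a (suc m) ≈ poch R a m * (a + nat m)
  poch-suc a zero = refl
  poch-suc a (suc m) = begin
    poch R a (suc (suc m))                         ≈⟨ poch-shift a (suc m) ⟩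
    a * poch R (1# + a) (suc m)                    ≈⟨ *-congˡ (poch-suc (1# + a) m) ⟩
    a * (poch R (1# + a) m * ((1# + a) + nat m))  ≈⟨ solve 3 (λ A P K → A :* (P :* ((κ 1 :+ A) :+ K)) := (A :* P) :* (A :+ (κ 1 :+ K))) refl a (poch R (1# + a) m) (nat m) ⟩
    (a * poch R (1# + a) m) * (a + nat (suc m))    ≈⟨ *-congʳ (sym (poch-shift a m)) ⟩
    poch R a (suc m) * (a + nat (suc m))           ∎

  poch-pair-suc : ∀ a b m → poch R a (suc m) * poch R b (suc m) ≈ (poch R a m * poch R b m) * ((a + nat m) * (b + nat m))
  poch-pair-suc a b m = trans (*-cong (poch-suc a m) (poch-suc b m))
    (solve 4 (λ A B U V → (A :* U) :* (B :* V) := (A :* B) :* (U :* V)) refl (poch R a m) (poch R b m) (a + nat m) (b + nat m))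

  φ-pochℚ-suc : ∀ a m → φ (pochℚ a (suc m)) ≈ φ (pochℚ a m) * (φ a + ι m)
  φ-pochℚ-suc a m = trans (φ-* _ _) (*-congˡ (φ-+ _ _))

  sumTo-linear : ∀ a b d f g h j →
    sumTo R (λ k → a * f k + b * g k + d * h k) j ≈ a * sumTo R f j + b * sumTo R g j + d * sumTo R h j
  sumTo-linear a b d f g h zero = refl
  sumTo-linear a b d f g h (suc j) = trans (+-congʳ (sumTo-linear a b d f g h j))
    (solve 9 (λ a b d F G H f g h → (a :* F :+ b :* G :+ d :* H) :+ (a :* f :+ b :* g :+ d :* h)
                                   := a :* (F :+ f) :+ b :* (G :+ g) :+ d :* (H :+ h)) refl a b d _ _ _ _ _ _)

  IsUnit : Carrier → Set _
  IsUnit = LeftInvertible 1# _*_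

  φ-invℚ-inverseˡ : ∀ q → q ≢ 0ℚ → φ (invℚ q) * φ q ≈ 1#
  φ-invℚ-inverseˡ q q≢0 with q ℚP.≟ 0ℚ
  ... | yes q≡0 = ⊥-elim (q≢0 q≡0)
  ... | no q≢0′ = trans (sym (φ-* _ q)) (trans (φ-cong (ℚP.*-inverseˡ q {{ℚ.≢-nonZero q≢0′}})) φ-1)

  inverse-factor : ∀ {v u w d} → v * u ≈ 1# → w * (u * d) ≈ 1# → v ≈ w * d
  inverse-factor {v} {u} {w} {d} vu≈1 wud≈1 = begin
    v                  ≈⟨ sym (*-identityʳ v) ⟩
    v * 1#             ≈⟨ *-congˡ (sym wud≈1) ⟩
    v * (w * (u * d))  ≈⟨ solve 4 (λ V W U D → V :* (W :* (U :* D)) := (V :* U) :* (W :* D)) refl v w u d ⟩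
    (v * u) * (w * d)  ≈⟨ *-congʳ vu≈1 ⟩
    1# * (w * d)       ≈⟨ *-identityˡ _ ⟩
    w * d              ∎

  unit-cancelˡ : ∀ {u a b} → IsUnit u → u * a ≈ u * b → a ≈ b
  unit-cancelˡ {u} {a} {b} (v , vu≈1) ua≈ub = begin
    a            ≈⟨ sym (*-identityˡ a) ⟩
    1# * a       ≈⟨ *-congʳ (sym vu≈1) ⟩
    (v * u) * a  ≈⟨ *-assoc v u a ⟩
    v * (u * a)  ≈⟨ *-congˡ ua≈ub ⟩
    v * (u * b)  ≈⟨ sym (*-assoc v u b) ⟩
    (v * u) * b  ≈⟨ *-congʳ vu≈1 ⟩
    1# * b       ≈⟨ *-identityˡ b ⟩
    b            ∎

  unit-* : ∀ {u w} → IsUnit u → IsUnit w → IsUnit (u * w)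
  unit-* {u} {w} (v , vu≈1) (z , zw≈1) = v * z , (begin
    (v * z) * (u * w)  ≈⟨ solve 4 (λ V Z U W → (V :* Z) :* (U :* W) := (V :* U) :* (Z :* W)) refl v z u w ⟩
    (v * u) * (z * w)  ≈⟨ *-cong vu≈1 zw≈1 ⟩
    1# * 1#            ≈⟨ *-identityˡ 1# ⟩
    1#                 ∎)

  unit-neg : ∀ {u} → IsUnit u → IsUnit (- u)
  unit-neg {u} (v , vu≈1) = - v , trans (solve 2 (λ V U → (:- V) :* (:- U) := V :* U) refl v u) vu≈1

  unit-resp : ∀ {u w} → u ≈ w → IsUnit u → IsUnit w
  unit-resp u≈w (v , vu≈1) = v , trans (*-congˡ (sym u≈w)) vu≈1

  ι-unit : ∀ m → m ≢ 0 → IsUnit (ι m)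
  ι-unit m m≢0 = φ (invℚ (ℕ→ℚ m)) , φ-invℚ-inverseˡ _ (ℕ→ℚ-≢0 m≢0)

  ι-∸-unit : ∀ a b → b ℕ.< a → IsUnit (ι a - ι b)
  ι-∸-unit a b b<a = unit-resp (ι-∸ a b (ℕP.<⇒≤ b<a))
    (ι-unit (a ℕ.∸ b) (λ a∸b≡0 → ℕP.<⇒≱ b<a (ℕP.m∸n≡0⇒m≤n a∸b≡0)))

  SatisfiesRecurrence : (a b d u : ℕ → Carrier) → Set _
  SatisfiesRecurrence a b d u = ∀ n → a n * u (suc (suc n)) + b n * u (suc n) + d n * u n ≈ 0#

  recurrence-unique : ∀ {a b d u v} → (∀ n → IsUnit (a n)) →
    SatisfiesRecurrence a b d u → SatisfiesRecurrence a b d v →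
    u 0 ≈ v 0 → u 1 ≈ v 1 → ∀ n → u n ≈ v n
  recurrence-unique {a} {b} {d} {u} {v} a-unit u-rec v-rec u₀≈v₀ u₁≈v₁ n = proj₁ (agree n)
    where
    isolate : ∀ {p q r} → p + q + r ≈ 0# → p ≈ - (q + r)
    isolate {p} {q} {r} p+q+r≈0 = begin
      p                      ≈⟨ solve 3 (λ P Q R → P := (P :+ Q :+ R) :- (Q :+ R)) refl p q r ⟩
      (p + q + r) - (q + r)  ≈⟨ +-congʳ p+q+r≈0 ⟩
      0# - (q + r)           ≈⟨ +-identityˡ _ ⟩
      - (q + r)              ∎

    agree : ∀ n → u n ≈ v n × u (suc n) ≈ v (suc n)
    agree zero = u₀≈v₀ , u₁≈v₁
    agree (suc n) with agree n
    ... | uₙ≈vₙ , uₙ₊₁≈vₙ₊₁ = uₙ₊₁≈vₙ₊₁ , unit-cancelˡ (a-unit n) (begin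
      a n * u (suc (suc n))            ≈⟨ isolate (u-rec n) ⟩
      - (b n * u (suc n) + d n * u n)  ≈⟨ -‿cong (+-cong (*-congˡ uₙ₊₁≈vₙ₊₁) (*-congˡ uₙ≈vₙ)) ⟩
      - (b n * v (suc n) + d n * v n)  ≈⟨ sym (isolate (v-rec n)) ⟩
      a n * v (suc (suc n))            ∎)

module ℚAlgebra = QAlgebra ℚring (λ q → q) (isRingHomomorphism _ P.refl)

p*q≢0 : ∀ {p q} → p ≢ 0ℚ → q ≢ 0ℚ → p ℚ.* q ≢ 0ℚ
p*q≢0 {p} {q} p≢0 q≢0 pq≡0 = q≢0 (begin
  q                   ≡⟨ P.sym (ℚP.*-identityˡ q) ⟩
  1ℚ ℚ.* q            ≡⟨ P.cong (ℚ._* q) (P.sym (ℚP.*-inverseˡ p {{ℚ.≢-nonZero p≢0}})) ⟩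
  (p⁻¹ ℚ.* p) ℚ.* q   ≡⟨ ℚP.*-assoc p⁻¹ p q ⟩
  p⁻¹ ℚ.* (p ℚ.* q)   ≡⟨ P.cong (p⁻¹ ℚ.*_) pq≡0 ⟩
  p⁻¹ ℚ.* 0ℚ          ≡⟨ ℚP.*-zeroʳ p⁻¹ ⟩
  0ℚ                  ∎)
  where
  open P.≡-Reasoning
  p⁻¹ : ℚ
  p⁻¹ = (ℚ.1/ p) {{ℚ.≢-nonZero p≢0}}

-- Clearing the denominator d of r turns r + j into the positive integer e + d j.
offset≢0 : ∀ r d e j → ℕ→ℚ d ℚ.* (r ℚ.+ ℕ→ℚ j) ≡ ℕ→ℚ (suc e) ℚ.+ ℕ→ℚ d ℚ.* ℕ→ℚ j → r ℚ.+ ℕ→ℚ j ≢ 0ℚ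
offset≢0 r d e j d[r+j]≡e+dj r+j≡0 = ℕ→ℚ-≢0 {suc e ℕ.+ d ℕ.* j} (λ ()) (begin
  ℕ→ℚ (suc e ℕ.+ d ℕ.* j)             ≡⟨ ℚAlgebra.ι-+ (suc e) (d ℕ.* j) ⟩
  ℕ→ℚ (suc e) ℚ.+ ℕ→ℚ (d ℕ.* j)       ≡⟨ P.cong (ℕ→ℚ (suc e) ℚ.+_) (ℚAlgebra.ι-* d j) ⟩
  ℕ→ℚ (suc e) ℚ.+ ℕ→ℚ d ℚ.* ℕ→ℚ j     ≡⟨ P.sym d[r+j]≡e+dj ⟩
  ℕ→ℚ d ℚ.* (r ℚ.+ ℕ→ℚ j)             ≡⟨ P.cong (ℕ→ℚ d ℚ.*_) r+j≡0 ⟩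
  ℕ→ℚ d ℚ.* 0ℚ                        ≡⟨ ℚP.*-zeroʳ (ℕ→ℚ d) ⟩
  0ℚ                                  ∎)
  where open P.≡-Reasoning

⅔ ⁴⁄₃ ¾ : ℚ
⅔ = ℤ.+ 2 ℚ./ 3
⁴⁄₃ = ℤ.+ 4 ℚ./ 3
¾ = ℤ.+ 3 ℚ./ 4

½+j≢0 : ∀ j → ½ ℚ.+ ℕ→ℚ j ≢ 0ℚ
½+j≢0 j = offset≢0 ½ 2 0 j (solve 1 (λ J → κ 2 :* (con ½ :+ J) := κ 1 :+ κ 2 :* J) P.refl (ℕ→ℚ j))
  where open ℚAlgebra using (solve; con; κ; _:+_; _:*_; _:=_)

⅔+j≢0 : ∀ j → ⅔ ℚ.+ ℕ→ℚ j ≢ 0ℚ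
⅔+j≢0 j = offset≢0 ⅔ 3 1 j (solve 1 (λ J → κ 3 :* (con ⅔ :+ J) := κ 2 :+ κ 3 :* J) P.refl (ℕ→ℚ j))
  where open ℚAlgebra using (solve; con; κ; _:+_; _:*_; _:=_)

⁴⁄₃+j≢0 : ∀ j → ⁴⁄₃ ℚ.+ ℕ→ℚ j ≢ 0ℚ
⁴⁄₃+j≢0 j = offset≢0 ⁴⁄₃ 3 3 j (solve 1 (λ J → κ 3 :* (con ⁴⁄₃ :+ J) := κ 4 :+ κ 3 :* J) P.refl (ℕ→ℚ j))
  where open ℚAlgebra using (solve; con; κ; _:+_; _:*_; _:=_)

-m+j≢0 : ∀ m j → j ℕ.< m → (ℚ.- ℕ→ℚ m) ℚ.+ ℕ→ℚ j ≢ 0ℚ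
-m+j≢0 m j j<m -m+j≡0 = ℕP.<⇒≢ j<m (ℕ→ℚ-injective (begin
  ℕ→ℚ j                               ≡⟨ solve 2 (λ M J → J := M :+ ((:- M) :+ J)) P.refl (ℕ→ℚ m) (ℕ→ℚ j) ⟩
  ℕ→ℚ m ℚ.+ ((ℚ.- ℕ→ℚ m) ℚ.+ ℕ→ℚ j)  ≡⟨ P.cong (ℕ→ℚ m ℚ.+_) -m+j≡0 ⟩
  ℕ→ℚ m ℚ.+ 0ℚ                        ≡⟨ ℚP.+-identityʳ _ ⟩
  ℕ→ℚ m                               ∎))
  where
  open P.≡-Reasoning
  open ℚAlgebra using (solve; _:+_; :-_; _:=_)

factℚ≢0 : ∀ k → factℚ k ≢ 0ℚ
factℚ≢0 zero = λ ()
factℚ≢0 (suc k) = p*q≢0 (factℚ≢0 k) (ℕ→ℚ-≢0 {suc k} (λ ()))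

pochℚ≢0 : ∀ a k → (∀ j → j ℕ.< k → a ℚ.+ ℕ→ℚ j ≢ 0ℚ) → pochℚ a k ≢ 0ℚ
pochℚ≢0 a zero _ = λ ()
pochℚ≢0 a (suc k) a+j≢0 = p*q≢0 (pochℚ≢0 a k (λ j j<k → a+j≢0 j (ℕP.m<n⇒m<1+n j<k))) (a+j≢0 k ℕP.≤-refl)

bracketDenℚ : ℕ → ℚ
bracketDenℚ m = pochℚ ⅔ m ℚ.* pochℚ ⁴⁄₃ m

bracketDenℚ≢0 : ∀ m → bracketDenℚ m ≢ 0ℚ
bracketDenℚ≢0 m = p*q≢0 (pochℚ≢0 ⅔ m (λ j _ → ⅔+j≢0 j)) (pochℚ≢0 ⁴⁄₃ m (λ j _ → ⁴⁄₃+j≢0 j))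

numℚ denℚ : ℕ → ℕ → ℚ
numℚ m k = pochℚ (ℚ.- ℕ→ℚ m) k ℚ.* powℚ ¾ k
denℚ m k = (factℚ k ℚ.* pochℚ ½ k) ℚ.* pochℚ (ℚ.- ℕ→ℚ (1 ℕ.+ 3 ℕ.* m)) k

denℚ≢0 : ∀ m k → k ℕ.≤ 1 ℕ.+ 3 ℕ.* m → denℚ m k ≢ 0ℚ
denℚ≢0 m k k≤1+3m = p*q≢0 (p*q≢0 (factℚ≢0 k) (pochℚ≢0 ½ k (λ j _ → ½+j≢0 j)))
  (pochℚ≢0 _ k (λ j j<k → -m+j≢0 (1 ℕ.+ 3 ℕ.* m) j (ℕP.<-≤-trans j<k k≤1+3m)))

module Identity {c ℓ : Level} (R : CommutativeRing c ℓ) (φ : ℚ → CommutativeRing.Carrier R)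
                (hom : IsQAlgebraMap R φ) (x : CommutativeRing.Carrier R) where
  open QAlgebra R φ hom

  module Template {m : ℕ} where
    3xᵖ tᵖ : Polynomial m → Polynomial m
    3xᵖ X = con (ℤ.+ 3 ℚ./ 1) :* X
    tᵖ X = 3xᵖ X :* (κ 1 :- 3xᵖ X)

    E₀ᵖ E₁ᵖ : Polynomial m → Polynomial m
    E₀ᵖ N = (κ 3 :* N :+ κ 2) :* (κ 3 :* N :+ κ 4)
    E₁ᵖ N = (κ 3 :* N :+ κ 5) :* (κ 3 :* N :+ κ 7)

    C₁ᵖ C₀ᵖ : Polynomial m → Polynomial m → Polynomial m
    C₁ᵖ X N = κ 1 :- κ 2 :* tᵖ X :- κ 9 :* ((N :+ κ 2) :* (N :+ κ 2)) :- κ 9 :* ((N :+ κ 1) :* (N :+ κ 1))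
    C₀ᵖ X N = κ 81 :* (((N :+ κ 1) :* (N :+ κ 1)) :* ((N :+ κ 1) :* (N :+ κ 1)))
              :- κ 9 :* ((N :+ κ 1) :* (N :+ κ 1)) :* (κ 1 :- κ 2 :* tᵖ X) :+ tᵖ X :* tᵖ X

    αᵖ βᵖ : Polynomial m → Polynomial m → Polynomial m
    αᵖ X M = ((κ 1 :+ X) :+ M) :* ((κ 1 :- X) :+ M)
    βᵖ X M = ((con ⅔ :+ X) :+ M) :* ((con ⁴⁄₃ :- X) :+ M)

    δᵖ : Polynomial m → Polynomial m
    δᵖ M = (con ⅔ :+ M) :* (con ⁴⁄₃ :+ M)

    ρᵖ : Polynomial m → Polynomial m → Polynomial m → Polynomial m
    ρᵖ X N K = (κ 6 :* K :- κ 3 :* (K :* K) :- κ 17 :* (K :* K :* K) :- κ 7 :* (K :* K :* K :* K) :+ K :* K :* K :* K :* K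
                 :+ N :* (κ 6 :* K :- κ 3 :* (K :* K) :- κ 18 :* (K :* K :* K) :- κ 9 :* (K :* K :* K :* K)))
               :+ (κ 6 :- κ 6 :* K :- κ 8 :* (K :* K) :- κ 2 :* (K :* K :* K) :+ N :* (κ 6 :- κ 6 :* K :- κ 6 :* (K :* K))) :* tᵖ X
               :+ (κ 3 :- κ 3 :* K :+ κ 3 :* N) :* (tᵖ X :* tᵖ X)

    Lᵖ : ℕ → Polynomial m → Polynomial m
    Lᵖ i N = κ 3 :* N :+ κ i

    Π₆ᵖ : Polynomial m → Polynomial m
    Π₆ᵖ N = Lᵖ 2 N :* (Lᵖ 3 N :* (Lᵖ 4 N :* (Lᵖ 5 N :* (Lᵖ 6 N :* Lᵖ 7 N))))

    f₂ᵖ f₁ᵖ f₀ᵖ : Polynomial m → Polynomial m → Polynomial m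
    f₂ᵖ N K = (Lᵖ 2 N :- K) :* (Lᵖ 3 N :- K) :* (Lᵖ 4 N :- K) :* (Lᵖ 5 N :- K) :* (Lᵖ 6 N :- K) :* (Lᵖ 7 N :- K)
    f₁ᵖ N K = (N :+ κ 2 :- K) :* (Lᵖ 5 N :* Lᵖ 7 N) :* ((Lᵖ 2 N :- K) :* (Lᵖ 3 N :- K) :* (Lᵖ 4 N :- K))
    f₀ᵖ N K = (N :+ κ 2 :- K) :* (N :+ κ 1 :- K) :* (Lᵖ 2 N :* Lᵖ 4 N :* Lᵖ 5 N :* Lᵖ 7 N)

    ratioDenᵖ refDenᵖ : Polynomial m → Polynomial m → Polynomial m
    ratioDenᵖ M K = κ 2 :* (κ 1 :+ K) :* (κ 2 :* K :+ κ 1) :* (K :- κ 1 :- κ 3 :* M)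
    refDenᵖ N K = κ 2 :* (κ 1 :+ K) :* (κ 2 :* K :+ κ 1) :* (κ 3 :* N :+ κ 1 :- K)

    natᵖ : ℕ → Polynomial m
    natᵖ zero = κ 0
    natᵖ (suc k) = κ 1 :+ natᵖ k

    pochᵖ : Polynomial m → ℕ → Polynomial m
    pochᵖ A zero = κ 1
    pochᵖ A (suc k) = pochᵖ A k :* (A :+ natᵖ k)

    pochsᵖ : Polynomial m → ℕ → Polynomial m
    pochsᵖ X k = pochᵖ (3xᵖ X) k :* pochᵖ (κ 1 :- 3xᵖ X) k

    rhsᵖ : Polynomial m → ℕ → Polynomial m → Polynomial m
    rhsᵖ X k Q = 3xᵖ X :* ((pochᵖ (κ 1 :+ X) k :* pochᵖ (κ 1 :- X) k) :* Q)
                 :+ (κ 1 :- 3xᵖ X) :* ((pochᵖ (con ⅔ :+ X) k :* pochᵖ (con ⁴⁄₃ :- X) k) :* Q)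
  open Template

  3x t : Carrier
  3x = φ (ℤ.+ 3 ℚ./ 1) * x
  t = 3x * (1# - 3x)

  E₀ E₁ C₁ C₀ : Carrier → Carrier
  E₀ N = (ι 3 * N + ι 2) * (ι 3 * N + ι 4)
  E₁ N = (ι 3 * N + ι 5) * (ι 3 * N + ι 7)
  C₁ N = 1# - ι 2 * t - ι 9 * ((N + ι 2) * (N + ι 2)) - ι 9 * ((N + 1#) * (N + 1#))
  C₀ N = ι 81 * (((N + 1#) * (N + 1#)) * ((N + 1#) * (N + 1#))) - ι 9 * ((N + 1#) * (N + 1#)) * (1# - ι 2 * t) + t * t

  -- The recurrence produced by Zeilberger's algorithm.
  p₂ p₁ p₀ : ℕ → Carrier
  p₂ n = E₁ (nat n) * E₀ (nat n)
  p₁ n = E₀ (nat n) * C₁ (nat n)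
  p₀ n = C₀ (nat n)

  p₂-unit : ∀ n → IsUnit (p₂ n)
  p₂-unit n = unit-* (unit-* (3n+ 5 (λ ())) (3n+ 7 (λ ()))) (unit-* (3n+ 2 (λ ())) (3n+ 4 (λ ())))
    where
    3n+ : ∀ i → i ≢ 0 → IsUnit (ι 3 * nat n + ι i)
    3n+ i i≢0 = unit-resp (trans (ι-+ i (3 ℕ.* n)) (trans (+-comm _ _) (+-congʳ (trans (ι-* 3 n) (*-congˡ (ι≈nat n))))))
                          (ι-unit (i ℕ.+ 3 ℕ.* n) (λ i+3n≡0 → i≢0 (ℕP.m+n≡0⇒m≡0 i i+3n≡0)))

  a₁ a₂ b₁ b₂ : Carrier
  a₁ = 1# + x
  a₂ = 1# - x
  b₁ = φ ⅔ + x
  b₂ = φ ⁴⁄₃ - x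

  rhs : ℕ → Carrier
  rhs n = 3x * bracket R φ a₁ a₂ ⅔ ⁴⁄₃ n + (1# - 3x) * bracket R φ b₁ b₂ ⅔ ⁴⁄₃ n

  α β δ : Carrier → Carrier
  α M = (a₁ + M) * (a₂ + M)
  β M = (b₁ + M) * (b₂ + M)
  δ M = (φ ⅔ + M) * (φ ⁴⁄₃ + M)

  bracketDen⁻¹ : ℕ → Carrier
  bracketDen⁻¹ m = φ (invℚ (bracketDenℚ m))

  φ-bracketDen-suc : ∀ m → φ (bracketDenℚ (suc m)) ≈ φ (bracketDenℚ m) * δ (nat m)
  φ-bracketDen-suc m = begin
    φ (bracketDenℚ (suc m))                                              ≈⟨ φ-* _ _ ⟩
    φ (pochℚ ⅔ (suc m)) * φ (pochℚ ⁴⁄₃ (suc m))                         ≈⟨ *-cong (φ-pochℚ-suc ⅔ m) (φ-pochℚ-suc ⁴⁄₃ m) ⟩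
    (φ (pochℚ ⅔ m) * (φ ⅔ + ι m)) * (φ (pochℚ ⁴⁄₃ m) * (φ ⁴⁄₃ + ι m))
      ≈⟨ solve 4 (λ A B U V → (A :* U) :* (B :* V) := (A :* B) :* (U :* V)) refl _ _ (φ ⅔ + ι m) (φ ⁴⁄₃ + ι m) ⟩
    (φ (pochℚ ⅔ m) * φ (pochℚ ⁴⁄₃ m)) * δ (ι m)                         ≈⟨ *-cong (sym (φ-* _ _)) (*-cong (+-congˡ (ι≈nat m)) (+-congˡ (ι≈nat m))) ⟩
    φ (bracketDenℚ m) * δ (nat m)                                        ∎

  bracketDen⁻¹-step : ∀ m → bracketDen⁻¹ m ≈ bracketDen⁻¹ (suc m) * δ (nat m)
  bracketDen⁻¹-step m = inverse-factor (φ-invℚ-inverseˡ _ (bracketDenℚ≢0 m))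
    (trans (*-congˡ (sym (φ-bracketDen-suc m))) (φ-invℚ-inverseˡ _ (bracketDenℚ≢0 (suc m))))

  rhs-recurrence : SatisfiesRecurrence p₂ p₁ p₀ rhs
  rhs-recurrence n = begin
    p₂ n * rhs (suc (suc n)) + p₁ n * rhs (suc n) + p₀ n * rhs n
      ≈⟨ +-cong (+-cong (*-congˡ rhs₂) (*-congˡ rhs₁)) (*-congˡ rhs₀) ⟩
    p₂ n * (3x * ((A * α N * α (1# + N)) * Q) + (1# - 3x) * ((B * β N * β (1# + N)) * Q))
      + p₁ n * (3x * ((A * α N) * Q₁) + (1# - 3x) * ((B * β N) * Q₁))
      + p₀ n * (3x * (A * Q₀) + (1# - 3x) * (B * Q₀))
      ≈⟨ solve 5 (λ X N A B Q →
           let Q₁ = Q :* δᵖ (κ 1 :+ N)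
               Q₀ = Q₁ :* δᵖ N
           in (E₁ᵖ N :* E₀ᵖ N) :* (3xᵖ X :* ((A :* αᵖ X N :* αᵖ X (κ 1 :+ N)) :* Q)
                                   :+ (κ 1 :- 3xᵖ X) :* ((B :* βᵖ X N :* βᵖ X (κ 1 :+ N)) :* Q))
              :+ (E₀ᵖ N :* C₁ᵖ X N) :* (3xᵖ X :* ((A :* αᵖ X N) :* Q₁) :+ (κ 1 :- 3xᵖ X) :* ((B :* βᵖ X N) :* Q₁))
              :+ C₀ᵖ X N :* (3xᵖ X :* (A :* Q₀) :+ (κ 1 :- 3xᵖ X) :* (B :* Q₀))
              := κ 0) refl x N A B Q ⟩
    0# ∎
    where
    N A B Q Q₁ Q₀ : Carrier
    N = nat n
    A = poch R a₁ n * poch R a₂ n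
    B = poch R b₁ n * poch R b₂ n
    Q = bracketDen⁻¹ (suc (suc n))
    Q₁ = Q * δ (1# + N)
    Q₀ = Q₁ * δ N

    Q₁≈ : bracketDen⁻¹ (suc n) ≈ Q₁
    Q₁≈ = bracketDen⁻¹-step (suc n)
    Q₀≈ : bracketDen⁻¹ n ≈ Q₀
    Q₀≈ = trans (bracketDen⁻¹-step n) (*-congʳ Q₁≈)

    rhs₂ : rhs (suc (suc n)) ≈ 3x * ((A * α N * α (1# + N)) * Q) + (1# - 3x) * ((B * β N * β (1# + N)) * Q)
    rhs₂ = +-cong (*-congˡ (*-congʳ (trans (poch-pair-suc a₁ a₂ (suc n)) (*-congʳ (poch-pair-suc a₁ a₂ n)))))
                  (*-congˡ (*-congʳ (trans (poch-pair-suc b₁ b₂ (suc n)) (*-congʳ (poch-pair-suc b₁ b₂ n)))))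
    rhs₁ : rhs (suc n) ≈ 3x * ((A * α N) * Q₁) + (1# - 3x) * ((B * β N) * Q₁)
    rhs₁ = +-cong (*-congˡ (*-cong (poch-pair-suc a₁ a₂ n) Q₁≈)) (*-congˡ (*-cong (poch-pair-suc b₁ b₂ n) Q₁≈))
    rhs₀ : rhs n ≈ 3x * (A * Q₀) + (1# - 3x) * (B * Q₀)
    rhs₀ = +-cong (*-congˡ (*-congˡ Q₀≈)) (*-congˡ (*-congˡ Q₀≈))

  pochs : ℕ → Carrier
  pochs k = poch R 3x k * poch R (1# - 3x) k

  coeff summand : ℕ → ℕ → Carrier
  coeff m k = φ (numℚ m k ℚ.* invℚ (denℚ m k))
  summand m k = pochs k * coeff m k

  lhs : ℕ → Carrier
  lhs m = sumTo R (summand m) m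

  pochs-suc : ∀ k → pochs (suc k) ≈ pochs k * (t + nat k + nat k * nat k)
  pochs-suc k = trans (poch-pair-suc 3x (1# - 3x) k)
    (*-congˡ (solve 2 (λ Y K → (Y :+ K) :* ((κ 1 :- Y) :+ K) := Y :* (κ 1 :- Y) :+ K :+ K :* K) refl 3x (nat k)))

  coeff-split : ∀ m k → coeff m k ≈ φ (numℚ m k) * φ (invℚ (denℚ m k))
  coeff-split m k = φ-* _ _

  ι-1+3m : ∀ m → ι (1 ℕ.+ 3 ℕ.* m) ≈ 1# + ι 3 * nat m
  ι-1+3m m = trans (ι-+ 1 (3 ℕ.* m)) (+-cong φ-1 (trans (ι-* 3 m) (*-congˡ (ι≈nat m))))

  ι-1+2k : ∀ k → ι (1 ℕ.+ 2 ℕ.* k) ≈ ι 2 * nat k + 1#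
  ι-1+2k k = trans (ι-+ 1 (2 ℕ.* k)) (trans (+-cong φ-1 (trans (ι-* 2 k) (*-congˡ (ι≈nat k)))) (+-comm _ _))

  φ-numℚ-suc : ∀ m k → φ (numℚ m (suc k)) ≈ φ (numℚ m k) * ((nat k - nat m) * φ ¾)
  φ-numℚ-suc m k = begin
    φ (numℚ m (suc k))                                                    ≈⟨ φ-* _ _ ⟩
    φ (pochℚ (ℚ.- ℕ→ℚ m) (suc k)) * φ (powℚ ¾ (suc k))                    ≈⟨ *-cong (φ-pochℚ-suc _ k) (φ-* _ _) ⟩
    (φ (pochℚ (ℚ.- ℕ→ℚ m) k) * (φ (ℚ.- ℕ→ℚ m) + ι k)) * (φ (powℚ ¾ k) * φ ¾)
      ≈⟨ *-congʳ (*-congˡ (+-cong (trans (φ-neg _) (-‿cong (ι≈nat m))) (ι≈nat k))) ⟩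
    (φ (pochℚ (ℚ.- ℕ→ℚ m) k) * (- nat m + nat k)) * (φ (powℚ ¾ k) * φ ¾)
      ≈⟨ solve 5 (λ A M K W Z → (A :* (:- M :+ K)) :* (W :* Z) := (A :* W) :* ((K :- M) :* Z)) refl _ _ _ _ _ ⟩
    (φ (pochℚ (ℚ.- ℕ→ℚ m) k) * φ (powℚ ¾ k)) * ((nat k - nat m) * φ ¾)  ≈⟨ *-congʳ (sym (φ-* _ _)) ⟩
    φ (numℚ m k) * ((nat k - nat m) * φ ¾)                                ∎

  denStep : ℕ → ℕ → Carrier
  denStep m k = (1# + nat k) * (φ ½ + nat k) * (- (1# + ι 3 * nat m) + nat k)

  φ-denℚ-suc : ∀ m k → φ (denℚ m (suc k)) ≈ φ (denℚ m k) * denStep m k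
  φ-denℚ-suc m k = begin
    φ (denℚ m (suc k))                                                    ≈⟨ φ-* _ _ ⟩
    φ (factℚ (suc k) ℚ.* pochℚ ½ (suc k)) * φ (pochℚ e (suc k))          ≈⟨ *-cong (φ-* _ _) (φ-pochℚ-suc _ k) ⟩
    (φ (factℚ (suc k)) * φ (pochℚ ½ (suc k))) * (φ (pochℚ e k) * (φ e + ι k))
      ≈⟨ *-cong (*-cong (φ-* _ _) (φ-pochℚ-suc _ k)) (*-congˡ (+-cong (trans (φ-neg _) (-‿cong (ι-1+3m m))) (ι≈nat k))) ⟩
    (φ (factℚ k) * ι (suc k)) * (φ (pochℚ ½ k) * (φ ½ + ι k)) * (φ (pochℚ e k) * (- (1# + ι 3 * nat m) + nat k))
      ≈⟨ *-congʳ (*-cong (*-congˡ (ι≈nat (suc k))) (*-congˡ (+-congˡ (ι≈nat k)))) ⟩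
    (φ (factℚ k) * (1# + nat k)) * (φ (pochℚ ½ k) * (φ ½ + nat k)) * (φ (pochℚ e k) * (- (1# + ι 3 * nat m) + nat k))
      ≈⟨ solve 6 (λ F A B U V W → ((F :* U) :* (A :* V)) :* (B :* W) := ((F :* A) :* B) :* (U :* V :* W)) refl _ _ _ _ _ _ ⟩
    ((φ (factℚ k) * φ (pochℚ ½ k)) * φ (pochℚ e k)) * denStep m k         ≈⟨ *-congʳ (trans (*-congʳ (sym (φ-* _ _))) (sym (φ-* _ _))) ⟩
    φ (denℚ m k) * denStep m k                                             ∎
    where
    e : ℚ
    e = ℚ.- ℕ→ℚ (1 ℕ.+ 3 ℕ.* m)

  ratioDen : ℕ → ℕ → Carrier
  ratioDen m k = ι 2 * (1# + nat k) * (ι 2 * nat k + 1#) * (nat k - 1# - ι 3 * nat m)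

  coeff-ratio : ∀ m k → k ℕ.< 1 ℕ.+ 3 ℕ.* m → coeff m (suc k) * ratioDen m k ≈ ι 3 * (nat k - nat m) * coeff m k
  coeff-ratio m k k<1+3m = begin
    coeff m (suc k) * ratioDen m k                              ≈⟨ *-congʳ (trans (coeff-split m (suc k)) (*-congʳ (φ-numℚ-suc m k))) ⟩
    (φ (numℚ m k) * ((nat k - nat m) * φ ¾)) * d⁻¹ * ratioDen m k
      ≈⟨ solve 4 (λ A K M U → (A :* ((K :- M) :* con ¾)) :* U :* ratioDenᵖ M K
                  := (A :* (U :* ((κ 1 :+ K) :* (con ½ :+ K) :* (:- (κ 1 :+ κ 3 :* M) :+ K)))) :* (κ 3 :* (K :- M)))
           refl (φ (numℚ m k)) (nat k) (nat m) d⁻¹ ⟩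
    (φ (numℚ m k) * (d⁻¹ * denStep m k)) * (ι 3 * (nat k - nat m))  ≈⟨ *-congʳ (*-congˡ (sym d⁻¹-step)) ⟩
    (φ (numℚ m k) * φ (invℚ (denℚ m k))) * (ι 3 * (nat k - nat m))  ≈⟨ trans (*-comm _ _) (*-congˡ (sym (coeff-split m k))) ⟩
    ι 3 * (nat k - nat m) * coeff m k                                ∎
    where
    d⁻¹ : Carrier
    d⁻¹ = φ (invℚ (denℚ m (suc k)))
    d⁻¹-step : φ (invℚ (denℚ m k)) ≈ d⁻¹ * denStep m k
    d⁻¹-step = inverse-factor (φ-invℚ-inverseˡ _ (denℚ≢0 m k (ℕP.<⇒≤ k<1+3m)))
                 (trans (*-congˡ (sym (φ-denℚ-suc m k))) (φ-invℚ-inverseˡ _ (denℚ≢0 m (suc k) k<1+3m)))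

  ratioDen-unit : ∀ m k → k ℕ.< 1 ℕ.+ 3 ℕ.* m → IsUnit (ratioDen m k)
  ratioDen-unit m k k<1+3m =
    unit-* (unit-* (unit-* (ι-unit 2 (λ ())) (unit-resp (ι≈nat (suc k)) (ι-unit (suc k) (λ ()))))
                   (unit-resp (ι-1+2k k) (ι-unit (1 ℕ.+ 2 ℕ.* k) (λ ()))))
           (unit-resp k-1-3m≈ (unit-neg (ι-∸-unit (1 ℕ.+ 3 ℕ.* m) k k<1+3m)))
    where
    k-1-3m≈ : - (ι (1 ℕ.+ 3 ℕ.* m) - ι k) ≈ nat k - 1# - ι 3 * nat m
    k-1-3m≈ = trans (-‿cong (+-cong (ι-1+3m m) (-‿cong (ι≈nat k))))
                    (solve 3 (λ K M W → :- ((κ 1 :+ W :* M) :- K) := K :- κ 1 :- W :* M) refl (nat k) (nat m) (ι 3))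

  coeff-0 : ∀ m → coeff m 0 ≈ 1#
  coeff-0 m = φ-1

  -- The series terminates: (-m)ₖ has the factor -m + m for k > m.
  φ-pochℚ-neg-vanishes : ∀ m j → φ (pochℚ (ℚ.- ℕ→ℚ m) (j ℕ.+ suc m)) ≈ 0#
  φ-pochℚ-neg-vanishes m zero =
    trans (φ-pochℚ-suc _ m) (trans (*-congˡ (trans (+-congʳ (φ-neg _)) (-‿inverseˡ _))) (zeroʳ _))
  φ-pochℚ-neg-vanishes m (suc j) =
    trans (φ-pochℚ-suc (ℚ.- ℕ→ℚ m) (j ℕ.+ suc m)) (trans (*-congʳ (φ-pochℚ-neg-vanishes m j)) (zeroˡ _))

  summand-vanishes : ∀ m j → summand m (j ℕ.+ suc m) ≈ 0#
  summand-vanishes m j = trans (*-congˡ coeff≈0) (zeroʳ _)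
    where
    coeff≈0 : coeff m (j ℕ.+ suc m) ≈ 0#
    coeff≈0 = trans (coeff-split m (j ℕ.+ suc m))
      (trans (*-congʳ (trans (φ-* _ _) (trans (*-congʳ (φ-pochℚ-neg-vanishes m j)) (zeroˡ _)))) (zeroˡ _))

  -- From cₖ = C·rₖ·F₀ and the ratios cₖ₊₁/cₖ = A/M, rₖ₊₁/rₖ = B/M′,
  -- two polynomial identities give cₖ₊₁ = C·rₖ₊₁·F₁.
  ratio-transfer : ∀ {M c c′ r r′ M′ A B C F₀ F₁ G} → IsUnit M →
    c′ * M ≈ A * c → r′ * M′ ≈ B * r → c ≈ C * (r * F₀) →
    M * (C * F₁) ≈ M′ * G → A * (C * F₀) ≈ B * G → c′ ≈ C * (r′ * F₁)
  ratio-transfer {M} {c} {c′} {r} {r′} {M′} {A} {B} {C} {F₀} {F₁} {G} M-unit c-ratio r-ratio c≈ e₁ e₂ =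
    unit-cancelˡ M-unit (begin
      M * c′               ≈⟨ *-comm _ _ ⟩
      c′ * M               ≈⟨ c-ratio ⟩
      A * c                ≈⟨ *-congˡ c≈ ⟩
      A * (C * (r * F₀))   ≈⟨ solve 4 (λ A C R F → A :* (C :* (R :* F)) := R :* (A :* (C :* F))) refl A C r F₀ ⟩
      r * (A * (C * F₀))   ≈⟨ *-congˡ e₂ ⟩
      r * (B * G)          ≈⟨ solve 3 (λ R B G → R :* (B :* G) := (B :* R) :* G) refl r B G ⟩
      (B * r) * G          ≈⟨ *-congʳ (sym r-ratio) ⟩
      (r′ * M′) * G        ≈⟨ *-assoc _ _ _ ⟩
      r′ * (M′ * G)        ≈⟨ *-congˡ (sym e₁) ⟩
      r′ * (M * (C * F₁))  ≈⟨ solve 4 (λ R M C F → R :* (M :* (C :* F)) := M :* (C :* (R :* F))) refl r′ M C F₁ ⟩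
      M * (C * (r′ * F₁))  ∎)

  ρ : Carrier → Carrier → Carrier
  ρ N K = (ι 6 * K - ι 3 * (K * K) - ι 17 * (K * K * K) - ι 7 * (K * K * K * K) + K * K * K * K * K
             + N * (ι 6 * K - ι 3 * (K * K) - ι 18 * (K * K * K) - ι 9 * (K * K * K * K)))
          + (ι 6 - ι 6 * K - ι 8 * (K * K) - ι 2 * (K * K * K) + N * (ι 6 - ι 6 * K - ι 6 * (K * K))) * t
          + (ι 3 - ι 3 * K + ι 3 * N) * (t * t)

  module Telescoping (n : ℕ) (1≤n : 1 ℕ.≤ n) where
    N : Carrier
    N = nat n

    L : ℕ → Carrier
    L i = ι 3 * N + ι i

    Π₆ : Carrier
    Π₆ = L 2 * (L 3 * (L 4 * (L 5 * (L 6 * L 7))))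

    3n+_ : ℕ → ℕ
    3n+ i = i ℕ.+ 3 ℕ.* n

    ι-3n+ : ∀ i → ι (3n+ i) ≈ L i
    ι-3n+ i = trans (ι-+ i (3 ℕ.* n)) (trans (+-congˡ (trans (ι-* 3 n) (*-congˡ (ι≈nat n)))) (+-comm _ _))

    ref₀Denℕ : ℕ
    ref₀Denℕ = 27 ℕ.* (3n+ 2 ℕ.* (3n+ 3 ℕ.* (3n+ 4 ℕ.* (3n+ 5 ℕ.* (3n+ 6 ℕ.* 3n+ 7)))))

    refDenℕ : ℕ → ℕ
    refDenℕ k = (2 ℕ.* suc k) ℕ.* (1 ℕ.+ 2 ℕ.* k) ℕ.* ((1 ℕ.+ 3 ℕ.* n) ℕ.∸ k)

    -- A hypergeometric term in k of which the coefficients of the ₃F₂ at n, n+1 and n+2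
    -- are polynomial multiples (coeff-n, coeff-n+1, coeff-n+2).
    ref : ℕ → Carrier
    ref zero = φ (invℚ (ℕ→ℚ ref₀Denℕ))
    ref (suc k) = (ι 3 * (N + ι 2 - nat k)) * ref k * φ (invℚ (ℕ→ℚ (refDenℕ k)))

    refDen : ℕ → Carrier
    refDen k = ι 2 * (1# + nat k) * (ι 2 * nat k + 1#) * (ι 3 * N + 1# - nat k)

    refDenℕ≢0 : ∀ k → k ℕ.≤ 3 ℕ.* n → refDenℕ k ≢ 0
    refDenℕ≢0 k k≤3n = ℕ.≢-nonZero⁻¹ (refDenℕ k)
      {{ℕP.m*n≢0 ((2 ℕ.* suc k) ℕ.* (1 ℕ.+ 2 ℕ.* k)) _ {{ℕP.m*n≢0 (2 ℕ.* suc k) (1 ℕ.+ 2 ℕ.* k)}} {{ℕ.≢-nonZero 1+3n∸k≢0}}}}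
      where
      1+3n∸k≢0 : (1 ℕ.+ 3 ℕ.* n) ℕ.∸ k ≢ 0
      1+3n∸k≢0 e = ℕP.<⇒≱ (ℕ.s≤s k≤3n) (ℕP.m∸n≡0⇒m≤n e)

    ι-refDenℕ : ∀ k → k ℕ.≤ 3 ℕ.* n → ι (refDenℕ k) ≈ refDen k
    ι-refDenℕ k k≤3n = begin
      ι (refDenℕ k)
        ≈⟨ trans (ι-* ((2 ℕ.* suc k) ℕ.* (1 ℕ.+ 2 ℕ.* k)) ((1 ℕ.+ 3 ℕ.* n) ℕ.∸ k)) (*-cong (trans (ι-* (2 ℕ.* suc k) (1 ℕ.+ 2 ℕ.* k)) (*-cong (trans (ι-* 2 (suc k)) (*-congˡ (ι≈nat (suc k)))) (ι-1+2k k)))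
                                   (trans (ι-∸ (1 ℕ.+ 3 ℕ.* n) k (ℕP.m≤n⇒m≤1+n k≤3n)) (+-cong (ι-1+3m n) (-‿cong (ι≈nat k))))) ⟩
      (ι 2 * (1# + nat k)) * (ι 2 * nat k + 1#) * ((1# + ι 3 * N) - nat k)
        ≈⟨ solve 3 (λ B K M → (κ 2 :* (κ 1 :+ K)) :* B :* ((κ 1 :+ κ 3 :* M) :- K) := κ 2 :* (κ 1 :+ K) :* B :* (κ 3 :* M :+ κ 1 :- K))
             refl (ι 2 * nat k + 1#) (nat k) N ⟩
      refDen k ∎

    ref-ratio : ∀ k → k ℕ.≤ 3 ℕ.* n → ref (suc k) * refDen k ≈ ι 3 * (N + ι 2 - nat k) * ref k
    ref-ratio k k≤3n = begin
      ref (suc k) * refDen k                   ≈⟨ *-congˡ (sym (ι-refDenℕ k k≤3n)) ⟩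
      (A * ref k * d⁻¹) * ι (refDenℕ k)        ≈⟨ *-assoc _ _ _ ⟩
      A * ref k * (d⁻¹ * ι (refDenℕ k))        ≈⟨ *-congˡ (φ-invℚ-inverseˡ _ (ℕ→ℚ-≢0 (refDenℕ≢0 k k≤3n))) ⟩
      A * ref k * 1#                           ≈⟨ *-identityʳ _ ⟩
      A * ref k                                ∎
      where
      A d⁻¹ : Carrier
      A = ι 3 * (N + ι 2 - nat k)
      d⁻¹ = φ (invℚ (ℕ→ℚ (refDenℕ k)))

    ref-0 : ref 0 * (ι 27 * Π₆) ≈ 1#
    ref-0 = trans (*-congˡ (sym ι-ref₀Denℕ)) (φ-invℚ-inverseˡ _ (ℕ→ℚ-≢0 {ref₀Denℕ} (λ ())))
      where
      ι-ref₀Denℕ : ι ref₀Denℕ ≈ ι 27 * Π₆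
      ι-ref₀Denℕ = trans (ι-* 27 (3n+ 2 ℕ.* (3n+ 3 ℕ.* (3n+ 4 ℕ.* (3n+ 5 ℕ.* (3n+ 6 ℕ.* 3n+ 7)))))) (*-congˡ
        (trans (ι-* (3n+ 2) (3n+ 3 ℕ.* (3n+ 4 ℕ.* (3n+ 5 ℕ.* (3n+ 6 ℕ.* 3n+ 7))))) (*-cong (ι-3n+ 2)
        (trans (ι-* (3n+ 3) (3n+ 4 ℕ.* (3n+ 5 ℕ.* (3n+ 6 ℕ.* 3n+ 7)))) (*-cong (ι-3n+ 3)
        (trans (ι-* (3n+ 4) (3n+ 5 ℕ.* (3n+ 6 ℕ.* 3n+ 7))) (*-cong (ι-3n+ 4)
        (trans (ι-* (3n+ 5) (3n+ 6 ℕ.* 3n+ 7)) (*-cong (ι-3n+ 5)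
        (trans (ι-* (3n+ 6) (3n+ 7)) (*-cong (ι-3n+ 6) (ι-3n+ 7))))))))))))

    f₂ f₁ f₀ : Carrier → Carrier
    f₂ K = (L 2 - K) * (L 3 - K) * (L 4 - K) * (L 5 - K) * (L 6 - K) * (L 7 - K)
    f₁ K = (N + ι 2 - K) * (L 5 * L 7) * ((L 2 - K) * (L 3 - K) * (L 4 - K))
    f₀ K = (N + ι 2 - K) * (N + 1# - K) * (L 2 * L 4 * L 5 * L 7)

    k≤1+n⇒k≤3n : ∀ {k} → k ℕ.≤ suc n → k ℕ.≤ 3 ℕ.* n
    k≤1+n⇒k≤3n k≤1+n = ℕP.≤-trans k≤1+n (ℕP.≤-trans (ℕ.s≤s (ℕP.m≤m+n n (n ℕ.+ 0))) (ℕP.+-monoˡ-≤ (n ℕ.+ (n ℕ.+ 0)) 1≤n))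

    coeff-n+2 : ∀ k → k ℕ.≤ suc (suc n) → coeff (suc (suc n)) k ≈ ι 27 * (ref k * f₂ (nat k))
    coeff-n+2 zero _ = trans (coeff-0 (suc (suc n))) (trans (sym ref-0)
      (solve 2 (λ B N → B :* (κ 27 :* Π₆ᵖ N) := κ 27 :* (B :* f₂ᵖ N (κ 0))) refl (ref 0) N))
    coeff-n+2 (suc k) k<2+n = ratio-transfer (ratioDen-unit (suc (suc n)) k k<) (coeff-ratio (suc (suc n)) k k<)
      (ref-ratio k (k≤1+n⇒k≤3n (ℕ.s≤s⁻¹ k<2+n))) (coeff-n+2 k (ℕP.m≤n⇒m≤1+n (ℕ.s≤s⁻¹ k<2+n)))
      (solve 2 (λ K N → ratioDenᵖ (κ 1 :+ (κ 1 :+ N)) K :* (κ 27 :* f₂ᵖ N (κ 1 :+ K)) := refDenᵖ N K :* Gᵖ K N) refl (nat k) N)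
      (solve 2 (λ K N → κ 3 :* (K :- (κ 1 :+ (κ 1 :+ N))) :* (κ 27 :* f₂ᵖ N K) := κ 3 :* (N :+ κ 2 :- K) :* Gᵖ K N) refl (nat k) N)
      where
      k< : k ℕ.< 1 ℕ.+ 3 ℕ.* suc (suc n)
      k< = ℕP.<-≤-trans k<2+n (ℕP.m≤n⇒m≤1+n (ℕP.m≤m+n (suc (suc n)) (2 ℕ.* suc (suc n))))
      Gᵖ : ∀ {m} → Polynomial m → Polynomial m → Polynomial m
      Gᵖ K N = κ 27 :* ((K :- κ 1 :- κ 3 :* (κ 1 :+ (κ 1 :+ N)))
                 :* ((Lᵖ 3 N :- (κ 1 :+ K)) :* (Lᵖ 4 N :- (κ 1 :+ K)) :* (Lᵖ 5 N :- (κ 1 :+ K)) :* (Lᵖ 6 N :- (κ 1 :+ K)) :* (Lᵖ 7 N :- (κ 1 :+ K))))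

    coeff-n+1 : ∀ k → k ℕ.≤ suc (suc n) → coeff (suc n) k ≈ ι 81 * (ref k * f₁ (nat k))
    coeff-n+1 zero _ = trans (coeff-0 (suc n)) (trans (sym ref-0)
      (solve 2 (λ B N → B :* (κ 27 :* Π₆ᵖ N) := κ 81 :* (B :* f₁ᵖ N (κ 0))) refl (ref 0) N))
    coeff-n+1 (suc k) k<2+n = ratio-transfer (ratioDen-unit (suc n) k k<) (coeff-ratio (suc n) k k<)
      (ref-ratio k (k≤1+n⇒k≤3n (ℕ.s≤s⁻¹ k<2+n))) (coeff-n+1 k (ℕP.m≤n⇒m≤1+n (ℕ.s≤s⁻¹ k<2+n)))
      (solve 2 (λ K N → ratioDenᵖ (κ 1 :+ N) K :* (κ 81 :* f₁ᵖ N (κ 1 :+ K)) := refDenᵖ N K :* Gᵖ K N) refl (nat k) N)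
      (solve 2 (λ K N → κ 3 :* (K :- (κ 1 :+ N)) :* (κ 81 :* f₁ᵖ N K) := κ 3 :* (N :+ κ 2 :- K) :* Gᵖ K N) refl (nat k) N)
      where
      k< : k ℕ.< 1 ℕ.+ 3 ℕ.* suc n
      k< = ℕP.<-≤-trans k<2+n (ℕ.s≤s (ℕ.s≤s (ℕP.m≤m+n n (2 ℕ.* suc n))))
      Gᵖ : ∀ {m} → Polynomial m → Polynomial m → Polynomial m
      Gᵖ K N = κ 81 :* ((K :- κ 1 :- κ 3 :* (κ 1 :+ N))
                 :* ((N :+ κ 2 :- (κ 1 :+ K)) :* (Lᵖ 5 N :* Lᵖ 7 N) :* ((Lᵖ 3 N :- (κ 1 :+ K)) :* (Lᵖ 4 N :- (κ 1 :+ K)))))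

    coeff-n : ∀ k → k ℕ.≤ suc (suc n) → coeff n k ≈ ι 243 * (ref k * f₀ (nat k))
    coeff-n zero _ = trans (coeff-0 n) (trans (sym ref-0)
      (solve 2 (λ B N → B :* (κ 27 :* Π₆ᵖ N) := κ 243 :* (B :* f₀ᵖ N (κ 0))) refl (ref 0) N))
    coeff-n (suc k) k<2+n = ratio-transfer (ratioDen-unit n k k<) (coeff-ratio n k k<)
      (ref-ratio k (k≤1+n⇒k≤3n (ℕ.s≤s⁻¹ k<2+n))) (coeff-n k (ℕP.m≤n⇒m≤1+n (ℕ.s≤s⁻¹ k<2+n)))
      (solve 2 (λ K N → ratioDenᵖ N K :* (κ 243 :* f₀ᵖ N (κ 1 :+ K)) := refDenᵖ N K :* Gᵖ K N) refl (nat k) N)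
      (solve 2 (λ K N → κ 3 :* (K :- N) :* (κ 243 :* f₀ᵖ N K) := κ 3 :* (N :+ κ 2 :- K) :* Gᵖ K N) refl (nat k) N)
      where
      k< : k ℕ.< 1 ℕ.+ 3 ℕ.* n
      k< = ℕ.s≤s (k≤1+n⇒k≤3n (ℕ.s≤s⁻¹ k<2+n))
      Gᵖ : ∀ {m} → Polynomial m → Polynomial m → Polynomial m
      Gᵖ K N = :- (κ 243 :* ((N :+ κ 2 :- (κ 1 :+ K)) :* (N :+ κ 1 :- (κ 1 :+ K)) :* (Lᵖ 2 N :* Lᵖ 4 N :* Lᵖ 5 N :* Lᵖ 7 N)))

    opSummand : ℕ → Carrier
    opSummand k = p₂ n * summand (suc (suc n)) k + p₁ n * summand (suc n) k + p₀ n * summand n k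

    -- The certificate ρ of creative telescoping: opSummand k = G (k+1) − G k, up to the factor 81.
    G : ℕ → Carrier
    G k = p₂ n * (ref k * (pochs k * ((N + ι 2 - nat k) * ρ N (nat k))))

    opSummand-0 : opSummand 0 ≈ ι 81 * G 0
    opSummand-0 = begin
      opSummand 0
        ≈⟨ +-cong (+-cong (*-congˡ (*-congˡ (coeff-n+2 0 ℕ.z≤n))) (*-congˡ (*-congˡ (coeff-n+1 0 ℕ.z≤n)))) (*-congˡ (*-congˡ (coeff-n 0 ℕ.z≤n))) ⟩
      p₂ n * (pochs 0 * (ι 27 * (ref 0 * f₂ 0#))) + p₁ n * (pochs 0 * (ι 81 * (ref 0 * f₁ 0#))) + p₀ n * (pochs 0 * (ι 243 * (ref 0 * f₀ 0#)))
        ≈⟨ solve 3 (λ B N X → (E₁ᵖ N :* E₀ᵖ N) :* ((κ 1 :* κ 1) :* (κ 27 :* (B :* f₂ᵖ N (κ 0))))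
                              :+ (E₀ᵖ N :* C₁ᵖ X N) :* ((κ 1 :* κ 1) :* (κ 81 :* (B :* f₁ᵖ N (κ 0))))
                              :+ C₀ᵖ X N :* ((κ 1 :* κ 1) :* (κ 243 :* (B :* f₀ᵖ N (κ 0))))
                            := κ 81 :* ((E₁ᵖ N :* E₀ᵖ N) :* (B :* ((κ 1 :* κ 1) :* ((N :+ κ 2 :- κ 0) :* ρᵖ X N (κ 0))))))
             refl (ref 0) N x ⟩
      ι 81 * G 0 ∎

    opSummand-suc : ∀ k → suc k ℕ.≤ suc (suc n) → opSummand (suc k) ≈ ι 81 * G (suc k) - ι 81 * G k
    opSummand-suc k k<2+n = unit-cancelˡ (ι-unit 3 (λ ())) (begin
      ι 3 * opSummand (suc k)
        ≈⟨ *-congˡ (+-cong (+-cong (*-congˡ (*-cong (pochs-suc k) (coeff-n+2 (suc k) k<2+n)))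
                                    (*-congˡ (*-cong (pochs-suc k) (coeff-n+1 (suc k) k<2+n))))
                           (*-congˡ (*-cong (pochs-suc k) (coeff-n (suc k) k<2+n)))) ⟩
      ι 3 * (p₂ n * ((Pₖ * s) * (ι 27 * (r * f₂ (1# + K)))) + p₁ n * ((Pₖ * s) * (ι 81 * (r * f₁ (1# + K))))
             + p₀ n * ((Pₖ * s) * (ι 243 * (r * f₀ (1# + K)))))
        ≈⟨ solve 5 (λ r Pₖ K N X →
              let s = tᵖ X :+ K :+ K :* K in
              κ 3 :* ((E₁ᵖ N :* E₀ᵖ N) :* ((Pₖ :* s) :* (κ 27 :* (r :* f₂ᵖ N (κ 1 :+ K))))
                      :+ (E₀ᵖ N :* C₁ᵖ X N) :* ((Pₖ :* s) :* (κ 81 :* (r :* f₁ᵖ N (κ 1 :+ K))))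
                      :+ C₀ᵖ X N :* ((Pₖ :* s) :* (κ 243 :* (r :* f₀ᵖ N (κ 1 :+ K)))))
              := κ 3 :* (κ 81 :* ((E₁ᵖ N :* E₀ᵖ N) :* (r :* ((Pₖ :* s) :* ((N :+ κ 2 :- (κ 1 :+ K)) :* ρᵖ X N (κ 1 :+ K))))))
                 :- κ 81 :* (((E₁ᵖ N :* E₀ᵖ N) :* (Pₖ :* ρᵖ X N K)) :* (r :* refDenᵖ N K)))
             refl r Pₖ K N x ⟩
      ι 3 * (ι 81 * (p₂ n * (r * ((Pₖ * s) * ((N + ι 2 - (1# + K)) * ρ N (1# + K))))))
        - ι 81 * ((p₂ n * (Pₖ * ρ N K)) * (r * refDen k))
        ≈⟨ +-cong (*-congˡ (*-congˡ (*-congˡ (*-congˡ (sym (*-congʳ (pochs-suc k))))))) (-‿cong (*-congˡ (sym 3Gₖ≈))) ⟩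
      ι 3 * (ι 81 * G (suc k)) - ι 81 * (ι 3 * G k)
        ≈⟨ solve 3 (λ W A B → W :* (κ 81 :* A) :- κ 81 :* (W :* B) := W :* (κ 81 :* A :- κ 81 :* B)) refl (ι 3) (G (suc k)) (G k) ⟩
      ι 3 * (ι 81 * G (suc k) - ι 81 * G k) ∎)
      where
      K r Pₖ s : Carrier
      K = nat k
      r = ref (suc k)
      Pₖ = pochs k
      s = t + K + K * K
      3Gₖ≈ : ι 3 * G k ≈ (p₂ n * (Pₖ * ρ N K)) * (r * refDen k)
      3Gₖ≈ = begin
        ι 3 * G k
          ≈⟨ solve 6 (λ W Π B Pₖ A ρ → W :* (Π :* (B :* (Pₖ :* (A :* ρ)))) := (Π :* (Pₖ :* ρ)) :* (W :* A :* B))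
               refl (ι 3) (p₂ n) (ref k) Pₖ (N + ι 2 - K) (ρ N K) ⟩
        (p₂ n * (Pₖ * ρ N K)) * (ι 3 * (N + ι 2 - K) * ref k)  ≈⟨ *-congˡ (sym (ref-ratio k (k≤1+n⇒k≤3n (ℕ.s≤s⁻¹ k<2+n)))) ⟩
        (p₂ n * (Pₖ * ρ N K)) * (r * refDen k)                ∎

    sum-opSummand : ∀ j → j ℕ.≤ suc (suc n) → sumTo R opSummand j ≈ ι 81 * G j
    sum-opSummand zero _ = opSummand-0
    sum-opSummand (suc j) j<2+n = begin
      sumTo R opSummand j + opSummand (suc j)        ≈⟨ +-cong (sum-opSummand j (ℕP.m≤n⇒m≤1+n (ℕ.s≤s⁻¹ j<2+n))) (opSummand-suc j j<2+n) ⟩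
      ι 81 * G j + (ι 81 * G (suc j) - ι 81 * G j)  ≈⟨ solve 2 (λ A B → κ 81 :* A :+ (κ 81 :* B :- κ 81 :* A) := κ 81 :* B) refl (G j) (G (suc j)) ⟩
      ι 81 * G (suc j)                               ∎

    G-top : G (suc (suc n)) ≈ 0#
    G-top = begin
      G (suc (suc n))                                                  ≈⟨ *-congˡ (*-congˡ (*-congˡ (*-congʳ N+2-[2+n]≈0))) ⟩
      p₂ n * (ref (suc (suc n)) * (pochs (suc (suc n)) * (0# * _)))  ≈⟨ *-congˡ (*-congˡ (*-congˡ (zeroˡ _))) ⟩
      p₂ n * (ref (suc (suc n)) * (pochs (suc (suc n)) * 0#))         ≈⟨ *-congˡ (*-congˡ (zeroʳ _)) ⟩
      p₂ n * (ref (suc (suc n)) * 0#)                                 ≈⟨ *-congˡ (zeroʳ _) ⟩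
      p₂ n * 0#                                                        ≈⟨ zeroʳ _ ⟩
      0#                                                               ∎
      where
      N+2-[2+n]≈0 : N + ι 2 - nat (suc (suc n)) ≈ 0#
      N+2-[2+n]≈0 = trans (+-congʳ (+-congˡ (ι≈nat 2))) (solve 1 (λ N → N :+ (κ 1 :+ (κ 1 :+ κ 0)) :- (κ 1 :+ (κ 1 :+ N)) := κ 0) refl N)

    lhs-recurrence : p₂ n * lhs (suc (suc n)) + p₁ n * lhs (suc n) + p₀ n * lhs n ≈ 0#
    lhs-recurrence = begin
      p₂ n * lhs (suc (suc n)) + p₁ n * lhs (suc n) + p₀ n * lhs n
        ≈⟨ +-cong (+-congˡ (*-congˡ lhs₁)) (*-congˡ lhs₀) ⟩
      p₂ n * sumTo R (summand (suc (suc n))) (suc (suc n)) + p₁ n * sumTo R (summand (suc n)) (suc (suc n))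
        + p₀ n * sumTo R (summand n) (suc (suc n))    ≈⟨ sym (sumTo-linear _ _ _ _ _ _ (suc (suc n))) ⟩
      sumTo R opSummand (suc (suc n))                 ≈⟨ sum-opSummand (suc (suc n)) ℕP.≤-refl ⟩
      ι 81 * G (suc (suc n))                          ≈⟨ *-congˡ G-top ⟩
      ι 81 * 0#                                       ≈⟨ zeroʳ _ ⟩
      0#                                              ∎
      where
      lhs₁ : lhs (suc n) ≈ sumTo R (summand (suc n)) (suc (suc n))
      lhs₁ = sym (trans (+-congˡ (summand-vanishes (suc n) 0)) (+-identityʳ _))
      lhs₀ : lhs n ≈ sumTo R (summand n) (suc (suc n))
      lhs₀ = sym (trans (+-cong (trans (+-congˡ (summand-vanishes n 0)) (+-identityʳ _)) (summand-vanishes n 1)) (+-identityʳ _))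

  -- The rational constants below are values of coeff and bracketDen⁻¹, which reduce by evaluation.
  lhs≈rhs-0 : lhs 0 ≈ rhs 0
  lhs≈rhs-0 = begin
    lhs 0                                                   ≈⟨ *-congˡ (coeff-0 0) ⟩
    pochs 0 * 1#                                            ≈⟨ solve 1 (λ X → pochsᵖ X 0 :* κ 1 := rhsᵖ X 0 (κ 1)) refl x ⟩
    3x * (1# * 1# * 1#) + (1# - 3x) * (1# * 1# * 1#)        ≈⟨ sym (+-cong (*-congˡ (*-congˡ φ-1)) (*-congˡ (*-congˡ φ-1))) ⟩
    rhs 0                                                   ∎

  lhs≈rhs-1 : lhs 1 ≈ rhs 1
  lhs≈rhs-1 = begin
    lhs 1                                    ≈⟨ +-congʳ (*-congˡ (coeff-0 1)) ⟩
    pochs 0 * 1# + pochs 1 * coeff 1 1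
      ≈⟨ solve 1 (λ X → pochsᵖ X 0 :* κ 1 :+ pochsᵖ X 1 :* con (ℤ.+ 3 ℚ./ 8) := rhsᵖ X 1 (con (ℤ.+ 9 ℚ./ 8))) refl x ⟩
    rhs 1                                    ∎

  lhs≈rhs-2 : lhs 2 ≈ rhs 2
  lhs≈rhs-2 = begin
    lhs 2                                                       ≈⟨ +-congʳ (+-congʳ (*-congˡ (coeff-0 2))) ⟩
    pochs 0 * 1# + pochs 1 * coeff 2 1 + pochs 2 * coeff 2 2
      ≈⟨ solve 1 (λ X → pochsᵖ X 0 :* κ 1 :+ pochsᵖ X 1 :* con (ℤ.+ 3 ℚ./ 7) :+ pochsᵖ X 2 :* con (ℤ.+ 1 ℚ./ 56)
                         := rhsᵖ X 2 (con (ℤ.+ 81 ℚ./ 280))) refl x ⟩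
    rhs 2                                                       ∎

  lhs≈rhs : ∀ n → lhs n ≈ rhs n
  lhs≈rhs zero = lhs≈rhs-0
  lhs≈rhs (suc n) =
    recurrence-unique {a = λ n → p₂ (suc n)} {λ n → p₁ (suc n)} {λ n → p₀ (suc n)}
      (λ n → p₂-unit (suc n)) (λ n → Telescoping.lhs-recurrence (suc n) (ℕ.s≤s ℕ.z≤n)) (λ n → rhs-recurrence (suc n))
      lhs≈rhs-1 lhs≈rhs-2 n

corollary10 : ∀ {c ℓ : Level} (R : CommutativeRing c ℓ) (φ : ℚ → CommutativeRing.Carrier R) →
    IsQAlgebraMap R φ →
    ∀ (n : ℕ) (x : CommutativeRing.Carrier R) →
    let open CommutativeRing R
        3x = φ (ℤ.+ 3 ℚ./ 1) * x
    in F32 R φ 3x (1# - 3x) n ½ (ℚ.- ℕ→ℚ (1 ℕ.+ 3 ℕ.* n)) (ℤ.+ 3 ℚ./ 4)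
       ≈ 3x * bracket R φ (1# + x) (1# - x) (ℤ.+ 2 ℚ./ 3) (ℤ.+ 4 ℚ./ 3) n
         + (1# - 3x) * bracket R φ (φ (ℤ.+ 2 ℚ./ 3) + x) (φ (ℤ.+ 4 ℚ./ 3) - x) (ℤ.+ 2 ℚ./ 3) (ℤ.+ 4 ℚ./ 3) n
corollary10 R φ hom n x = Identity.lhs≈rhs R φ hom x n
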